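{- For every $n\geq 3$ there is an optimal $(n,n-1)$-graph for split reliability.
   Context: A graph has a finite vertex set and a finite multiset of edges (unordered pairs of vertices; multiple edges allowed); an $(n,m)$-graph has $n$ vertices and $m$ edges. Each edge is independently operational with probability $p$, vertices always operational. For distinct terminals $s,t$, the split reliability $\mathrm{Sp}(G;s,t)$ is the probability that the operational spanning subgraph has exactly two components, one containing $s$, the other containing $t$. A connected $(n,m)$-graph $G$ with distinct terminals $s,t$ is an optimal $(n,m)$-graph if for every connected $(n,m)$-graph $H$, every pair of distinct vertices $s',t'$ of $H$, and every $p\in(0,1)$, $\mathrm{Sp}(G;s,t)\geq \mathrm{Sp}(H;s',t')$.
   Formalization: The edge probability p in the definition of an optimal $(n,m)$-graph ranges only over rational values in (0,1). -}

module Defs where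

open import Data.Nat using (ℕ; zero; suc)
open import Data.Bool using (Bool; true; false; _∨_; _∧_; not; if_then_else_)
open import Data.Fin using (Fin; _≟_; toℕ)
open import Data.Fin.Properties using () renaming (_≤?_ to _≤F?_)
open import Data.Product using (_×_; _,_; ∃)
open import Data.Vec using (Vec; []; _∷_; allFin)
import Data.Vec as Vec
open import Data.List using (List; []; _∷_; _++_; map; foldr)
open import Data.Rational using (ℚ; 0ℚ; 1ℚ; _+_; _*_; _-_; _≤_; _<_)
open import Relation.Nullary.Decidable using (⌊_⌋)
open import Relation.Binary.PropositionalEquality using (_≡_; _≢_)

-- An (n,m)-graph: vertex set Fin n, and an indexed family (multiset) of m
-- edges, each an (unordered) pair of vertices given by its two endpoints.
Graph : ℕ → ℕ → Set
Graph n m = Vec (Fin n × Fin n) m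

EdgeState : ℕ → Set
EdgeState m = Vec Bool m

allStates : (m : ℕ) → List (EdgeState m)
allStates zero = [] ∷ []
allStates (suc m) = map (true ∷_) (allStates m) ++ map (false ∷_) (allStates m)

anyV : ∀ {k} {A : Set} → (A → Bool) → Vec A k → Bool
anyV f [] = false
anyV f (x ∷ xs) = f x ∨ anyV f xs

allV : ∀ {k} {A : Set} → (A → Bool) → Vec A k → Bool
allV f [] = true
allV f (x ∷ xs) = f x ∧ allV f xs

_==_ : ∀ {n} → Fin n → Fin n → Bool
a == b = ⌊ a ≟ b ⌋

Rel : ℕ → Set
Rel n = Fin n → Fin n → Bool

step : ∀ {n m} → Graph n m → EdgeState m → Rel n → Rel n
step G S R u v = R u v ∨ anyV (λ { ((a , b) , o) → o ∧ ((R u a ∧ (b == v)) ∨ (R u b ∧ (a == v))) }) (Vec.zip G S)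

iter : ∀ {n m} → ℕ → Graph n m → EdgeState m → Rel n → Rel n
iter zero G S R = R
iter (suc k) G S R = iter k G S (step G S R)

-- reach G S u v = true iff v is reachable from u in the spanning subgraph of
-- operational edges (n iterations of the closure suffice)
reach : ∀ {n m} → Graph n m → EdgeState m → Rel n
reach {n} G S = iter n G S _==_

-- number of connected components of the operational spanning subgraph:
-- number of vertices that are the least vertex of their component
components : ∀ {n m} → Graph n m → EdgeState m → ℕ
components {n} G S = Vec.count (λ v → Data.Bool.T? (allV (λ u → not (reach G S v u) ∨ ⌊ v ≤F? u ⌋) (allFin n))) (allFin n)
  where import Data.Bool

splitEvent : ∀ {n m} → Graph n m → Fin n → Fin n → EdgeState m → Bool
splitEvent G s t S = ⌊ components G S Data.Nat.≟ 2 ⌋ ∧ not (reach G S s t)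
  where import Data.Nat

allOnes : (m : ℕ) → EdgeState m
allOnes m = Vec.replicate m true

Connected : ∀ {n m} → Graph n m → Set
Connected {n} {m} G = ∀ u v → reach G (allOnes m) u v ≡ true

prob : ∀ {m} → ℚ → EdgeState m → ℚ
prob p [] = 1ℚ
prob p (true ∷ S) = p * prob p S
prob p (false ∷ S) = (1ℚ - p) * prob p S

Sp : ∀ {n m} → Graph n m → Fin n → Fin n → ℚ → ℚ
Sp {n} {m} G s t p =
  foldr (λ S acc → (if splitEvent G s t S then prob p S else 0ℚ) + acc) 0ℚ (allStates m)

Optimal : ∀ {n m} → Graph n m → Fin n → Fin n → Set
Optimal {n} {m} G s t =
  Connected G × s ≢ t ×
  (∀ (H : Graph n m) (s' t' : Fin n) → Connected H → s' ≢ t' →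
     ∀ (p : ℚ) → 0ℚ < p → p < 1ℚ → Sp H s' t' p ≤ Sp G s t p)

-- The path on n vertices, with its ends as terminals, is optimal. Each operational edge merges at
-- most two components, so a state of an (n, n - 1)-graph with two components has at most one
-- failed edge; if the graph is connected and the state separates the terminals, exactly one edge
-- fails. Every state of the path with exactly one failed edge separates its ends into two
-- components. Hence the split event of any connected (n, n - 1)-graph is contained, state by state,
-- in that of the path, and Sp is monotone in the event.

module Submission where

open import Defs
open import Data.Nat using (ℕ; _≤_; _∸_)
open import Data.Fin using (Fin)
open import Data.Product using (∃)

open import Data.Bool using (Bool; true; false; T; T?; _∨_; _∧_; not; if_then_else_)
open import Data.Bool.Properties using (T-∨; T-∧; T-≡)
open import Data.Empty using (⊥; ⊥-elim)
open import Data.Fin using (zero; suc; inject₁; fromℕ; toℕ) renaming (_≤_ to _≤ᶠ_; _<_ to _<ᶠ_)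
open import Data.Fin.Induction using (<-weakInduction)
import Data.Fin.Properties as Finₚ
open import Data.List as List using (List; foldr)
open import Data.Nat using (suc; zero; _+_; _<_; z≤n; s≤s)
import Data.Nat.Properties as ℕₚ
open import Data.Product using (_×_; _,_)
open import Data.Rational as ℚ using (ℚ; 0ℚ; 1ℚ)
import Data.Rational.Properties as ℚₚ
open import Data.Sum as Sum using (_⊎_; inj₁; inj₂)
open import Data.Vec using ([]; _∷_; lookup; tabulate; allFin; zip; count; _[_]≔_)
import Data.Vec.Properties as Vecₚ
open import Function using (_∘_; id; _⇔_; mk⇔; Equivalence)
open Equivalence using (to; from)
open import Level using (Level)
open import Relation.Binary.Construct.Closure.ReflexiveTransitive as Star using (Star; ε; _◅_; _◅◅_)
open import Relation.Binary.PropositionalEquality using (_≡_; _≢_; refl; sym; trans; cong; subst)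
open import Relation.Nullary using (yes; no; ¬_; contradiction)
open import Relation.Nullary.Decidable as Dec using (⌊_⌋; toWitness; fromWitness; _×-dec_; _→-dec_; ¬?)
open import Relation.Unary using (Pred; Decidable)

private
  variable
    n m : ℕ
    p q : Level

#_ : ∀ {P : Pred (Fin n) p} → Decidable P → ℕ
#_ {n = zero}  P? = 0
#_ {n = suc n} P? with P? zero
... | yes _ = suc (# (P? ∘ suc))
... | no  _ = # (P? ∘ suc)

count-tabulate : ∀ {a} {A : Set a} {P : Pred A p} (P? : Decidable P) (f : Fin n → A) →
                 count P? (tabulate f) ≡ # (P? ∘ f)
count-tabulate {n = zero}  P? f = refl
count-tabulate {n = suc n} P? f with P? (f zero)
... | yes _ = cong suc (count-tabulate P? (f ∘ suc))
... | no  _ = count-tabulate P? (f ∘ suc)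

#-mono : ∀ {P : Pred (Fin n) p} {Q : Pred (Fin n) q} (P? : Decidable P) (Q? : Decidable Q) →
         (∀ i → P i → Q i) → # P? ≤ # Q?
#-mono {n = zero}  P? Q? P⇒Q = z≤n
#-mono {n = suc n} P? Q? P⇒Q with P? zero | Q? zero | #-mono (P? ∘ suc) (Q? ∘ suc) (P⇒Q ∘ suc)
... | yes _  | yes _  | ih = s≤s ih
... | yes Pz | no ¬Qz | _  = contradiction (P⇒Q zero Pz) ¬Qz
... | no _   | yes _  | ih = ℕₚ.m≤n⇒m≤1+n ih
... | no _   | no _   | ih = ih

#-cong : ∀ {P : Pred (Fin n) p} {Q : Pred (Fin n) q} (P? : Decidable P) (Q? : Decidable Q) →
         (∀ i → P i ⇔ Q i) → # P? ≡ # Q?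
#-cong P? Q? P⇔Q = ℕₚ.≤-antisym (#-mono P? Q? (to ∘ P⇔Q)) (#-mono Q? P? (from ∘ P⇔Q))

#-strict : ∀ {P : Pred (Fin n) p} {Q : Pred (Fin n) q} (P? : Decidable P) (Q? : Decidable Q) →
           (∀ i → P i → Q i) → ∀ {j} → Q j → ¬ P j → # P? < # Q?
#-strict {n = suc n} P? Q? P⇒Q {zero} Qj ¬Pj with P? zero | Q? zero
... | yes Pz | _      = contradiction Pz ¬Pj
... | no _   | yes _  = s≤s (#-mono (P? ∘ suc) (Q? ∘ suc) (P⇒Q ∘ suc))
... | no _   | no ¬Qz = contradiction Qj ¬Qz
#-strict {n = suc n} P? Q? P⇒Q {suc j} Qj ¬Pj
  with P? zero | Q? zero | #-strict (P? ∘ suc) (Q? ∘ suc) (P⇒Q ∘ suc) Qj ¬Pj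
... | yes _  | yes _  | ih = s≤s ih
... | yes Pz | no ¬Qz | _  = contradiction (P⇒Q zero Pz) ¬Qz
... | no _   | yes _  | ih = ℕₚ.m<n⇒m<1+n ih
... | no _   | no _   | ih = ih

#-≤-suc : ∀ {P : Pred (Fin n) p} {Q : Pred (Fin n) q} (P? : Decidable P) (Q? : Decidable Q) →
          (∀ {i j} → P i → ¬ Q i → P j → ¬ Q j → i ≡ j) → # P? ≤ suc (# Q?)
#-≤-suc {n = zero}  P? Q? unique = z≤n
#-≤-suc {n = suc n} {P = P} {Q = Q} P? Q? unique
  with P? zero | Q? zero
     | #-≤-suc (P? ∘ suc) (Q? ∘ suc) (λ Pi ¬Qi Pj ¬Qj → Finₚ.suc-injective (unique Pi ¬Qi Pj ¬Qj))
... | yes _  | yes _  | ih = s≤s ih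
... | yes Pz | no ¬Qz | _  = s≤s (#-mono (P? ∘ suc) (Q? ∘ suc) only-exception)
  where
  only-exception : ∀ i → P (suc i) → Q (suc i)
  only-exception i Psi with Q? (suc i)
  ... | yes Qsi = Qsi
  ... | no ¬Qsi with () ← unique Psi ¬Qsi Pz ¬Qz
... | no _   | yes _  | ih = ℕₚ.m≤n⇒m≤1+n ih
... | no _   | no _   | ih = ih

#≤n : ∀ {P : Pred (Fin n) p} (P? : Decidable P) → # P? ≤ n
#≤n {n = zero}  P? = z≤n
#≤n {n = suc n} P? with P? zero
... | yes _ = s≤s (#≤n (P? ∘ suc))
... | no  _ = ℕₚ.m≤n⇒m≤1+n (#≤n (P? ∘ suc))

#-all : ∀ {P : Pred (Fin n) p} (P? : Decidable P) → (∀ i → P i) → # P? ≡ n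
#-all {n = zero}  P? all = refl
#-all {n = suc n} P? all with P? zero
... | yes _  = cong suc (#-all (P? ∘ suc) (all ∘ suc))
... | no ¬Pz = contradiction (all zero) ¬Pz

#-none : ∀ {P : Pred (Fin n) p} (P? : Decidable P) → (∀ i → ¬ P i) → # P? ≡ 0
#-none {n = zero}  P? none = refl
#-none {n = suc n} P? none with P? zero
... | yes Pz = contradiction Pz (none zero)
... | no  _  = #-none (P? ∘ suc) (none ∘ suc)

==-refl : (x : Fin n) → T (x == x)
==-refl x = fromWitness refl

T-not : ∀ b → T (not b) ⇔ (¬ T b)
T-not true  = mk⇔ (λ ()) (λ ¬t → ¬t _)
T-not false = mk⇔ (λ _ ()) (λ _ → _)

T-implies : ∀ a b → T (not a ∨ b) ⇔ (T a → T b)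
T-implies true  b = mk⇔ (λ t _ → t) (λ f → f _)
T-implies false b = mk⇔ (λ _ ()) (λ _ → _)

allV-tabulate : ∀ {A : Set} (f : A → Bool) (g : Fin n → A) → T (allV f (tabulate g)) ⇔ (∀ i → T (f (g i)))
allV-tabulate {n = zero}  f g = mk⇔ (λ _ ()) (λ _ → _)
allV-tabulate {n = suc n} f g = mk⇔
  (λ t → let head , tail = to T-∧ t in λ { zero → head ; (suc i) → to (allV-tabulate f (g ∘ suc)) tail i })
  (λ all → from T-∧ (all zero , from (allV-tabulate f (g ∘ suc)) (all ∘ suc)))

Joins : Fin n × Fin n → Fin n → Fin n → Set
Joins (a , b) x y = (a ≡ x × b ≡ y) ⊎ (a ≡ y × b ≡ x)

record Adj (G : Graph n m) (S : EdgeState m) (x y : Fin n) : Set where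
  constructor adj
  field
    edge        : Fin m
    operational : T (lookup S edge)
    joins       : Joins (lookup G edge) x y

Conn : Graph n m → EdgeState m → Fin n → Fin n → Set
Conn G S = Star (Adj G S)

Joins-sym : ∀ (e : Fin n × Fin n) {x y} → Joins e x y → Joins e y x
Joins-sym e (inj₁ (a≡x , b≡y)) = inj₂ (a≡x , b≡y)
Joins-sym e (inj₂ (a≡y , b≡x)) = inj₁ (a≡y , b≡x)

Adj-sym : ∀ {G : Graph n m} {S x y} → Adj G S x y → Adj G S y x
Adj-sym {G = G} (adj j on joins) = adj j on (Joins-sym (lookup G j) joins)

Conn-sym : ∀ {G : Graph n m} {S x y} → Conn G S x y → Conn G S y x
Conn-sym = Star.reverse Adj-sym

Conn-[] : ∀ {x y : Fin n} → Conn [] [] x y → x ≡ y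
Conn-[] ε              = refl
Conn-[] (adj () _ _ ◅ _)

Conn-∷⁺ : ∀ {G : Graph n m} {S x y} e o → Conn G S x y → Conn (e ∷ G) (o ∷ S) x y
Conn-∷⁺ e o = Star.map λ (adj j on joins) → adj (suc j) on joins

Conn-∷-false⁻ : ∀ {G : Graph n m} {S x y} e → Conn (e ∷ G) (false ∷ S) x y → Conn G S x y
Conn-∷-false⁻ e = Star.map λ where (adj (suc j) on joins) → adj j on joins

Conn-∷-true⁻ : ∀ {G : Graph n m} {S a b x y} → Conn ((a , b) ∷ G) (true ∷ S) x y →
               Conn G S x y ⊎ (Conn G S x a × Conn G S b y) ⊎ (Conn G S x b × Conn G S a y)
Conn-∷-true⁻ ε = inj₁ ε
Conn-∷-true⁻ (adj (suc j) on joins ◅ zy) with Conn-∷-true⁻ zy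
... | inj₁ zy′               = inj₁ (adj j on joins ◅ zy′)
... | inj₂ (inj₁ (za , by))  = inj₂ (inj₁ (adj j on joins ◅ za , by))
... | inj₂ (inj₂ (zb , ay))  = inj₂ (inj₂ (adj j on joins ◅ zb , ay))
Conn-∷-true⁻ (adj zero _ (inj₁ (refl , refl)) ◅ by) with Conn-∷-true⁻ by
... | inj₁ by′               = inj₂ (inj₁ (ε , by′))
... | inj₂ (inj₁ (_ , by′))  = inj₂ (inj₁ (ε , by′))
... | inj₂ (inj₂ (_ , ay))   = inj₁ ay
Conn-∷-true⁻ (adj zero _ (inj₂ (refl , refl)) ◅ ay) with Conn-∷-true⁻ ay
... | inj₁ ay′               = inj₂ (inj₂ (ε , ay′))
... | inj₂ (inj₁ (_ , by))   = inj₁ by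
... | inj₂ (inj₂ (_ , ay′))  = inj₂ (inj₂ (ε , ay′))

-- The test `step` applies to each edge: `step G S R u v` is definitionally
-- `R u v ∨ anyV (extends R u v) (zip G S)`.
extends : Rel n → Fin n → Fin n → (Fin n × Fin n) × Bool → Bool
extends R u v ((a , b) , o) = o ∧ ((R u a ∧ (b == v)) ∨ (R u b ∧ (a == v)))

extends-sound : ∀ (G : Graph n m) S R u {v} → T (anyV (extends R u v) (zip G S)) →
                ∃ λ x → T (R u x) × Adj G S x v
extends-sound [] [] R u ()
extends-sound ((a , b) ∷ G) (o ∷ S) R u t with to T-∨ t
... | inj₂ rest = let x , Rux , adj j on joins = extends-sound G S R u rest in x , Rux , adj (suc j) on joins
... | inj₁ here with to T-∧ here
... | on , t′ with to T-∨ t′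
... | inj₁ ab = let Rua , b≡v = to T-∧ ab in a , Rua , adj zero on (inj₁ (refl , toWitness b≡v))
... | inj₂ ba = let Rub , a≡v = to T-∧ ba in b , Rub , adj zero on (inj₂ (toWitness a≡v , refl))

extends-complete : ∀ (G : Graph n m) S R u {x v} → T (R u x) → Adj G S x v → T (anyV (extends R u v) (zip G S))
extends-complete (_ ∷ G) (_ ∷ S) R u Rux (adj (suc j) on joins) =
  from T-∨ (inj₂ (extends-complete G S R u Rux (adj j on joins)))
extends-complete (_ ∷ G) (_ ∷ S) R u Rux (adj zero on (inj₁ (refl , refl))) =
  from T-∨ (inj₁ (from T-∧ (on , from T-∨ (inj₁ (from T-∧ (Rux , ==-refl _))))))
extends-complete (_ ∷ G) (_ ∷ S) R u Rux (adj zero on (inj₂ (refl , refl))) =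
  from T-∨ (inj₁ (from T-∧ (on , from T-∨ (inj₂ (from T-∧ (Rux , ==-refl _))))))

module _ {G : Graph n m} {S : EdgeState m} where

  step-sound : ∀ R u {v} → T (step G S R u v) → T (R u v) ⊎ ∃ λ x → T (R u x) × Adj G S x v
  step-sound R u t = Sum.map₂ (extends-sound G S R u) (to T-∨ t)

  step-extends : ∀ R u {x v} → T (R u x) → Adj G S x v → T (step G S R u v)
  step-extends R u Rux x~v = from T-∨ (inj₂ (extends-complete G S R u Rux x~v))

  step-inflationary : ∀ R u {v} → T (R u v) → T (step G S R u v)
  step-inflationary R u Ruv = from T-∨ (inj₁ Ruv)

  step-mono : ∀ R R′ u → (∀ v → T (R u v) → T (R′ u v)) →
              ∀ v → T (step G S R u v) → T (step G S R′ u v)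
  step-mono R R′ u R⊆R′ v t with step-sound R u t
  ... | inj₁ Ruv             = step-inflationary R′ u (R⊆R′ v Ruv)
  ... | inj₂ (x , Rux , x~v) = step-extends R′ u (R⊆R′ x Rux) x~v

  iter-inflationary : ∀ k R u {v} → T (R u v) → T (iter k G S R u v)
  iter-inflationary zero    R u Ruv = Ruv
  iter-inflationary (suc k) R u Ruv = iter-inflationary k (step G S R) u (step-inflationary R u Ruv)

  iter-sound : ∀ k R u → (∀ v → T (R u v) → Conn G S u v) → ∀ v → T (iter k G S R u v) → Conn G S u v
  iter-sound zero    R u sound = sound
  iter-sound (suc k) R u sound = iter-sound k (step G S R) u sound′
    where
    sound′ : ∀ v → T (step G S R u v) → Conn G S u v
    sound′ v t with step-sound R u t
    ... | inj₁ Ruv             = sound v Ruv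
    ... | inj₂ (x , Rux , x~v) = sound x Rux ◅◅ x~v ◅ ε

  reach-sound : ∀ {u v} → T (reach G S u v) → Conn G S u v
  reach-sound {u} = iter-sound n _==_ u (λ v u≡v → subst (Conn G S u) (toWitness u≡v) ε) _

  Stable : Rel n → Fin n → Set
  Stable R u = ∀ v → T (step G S R u v) → T (R u v)

  stable-step : ∀ R u → Stable R u → Stable (step G S R) u
  stable-step R u = step-mono (step G S R) R u

  iter-stable : ∀ k R u → Stable R u → ∀ v → T (iter k G S R u v) → T (R u v)
  iter-stable zero    R u st v t = t
  iter-stable (suc k) R u st v t = st v (iter-stable k (step G S R) u (stable-step R u st) v t)

  stable-closed : ∀ R u → Stable R u → ∀ {x y} → T (R u x) → Conn G S x y → T (R u y)
  stable-closed R u st Rux ε           = Rux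
  stable-closed R u st Rux (x~z ◅ z~y) = stable-closed R u st (st _ (step-extends R u Rux x~z)) z~y

  stable-iter : ∀ k R u → Stable R u → Stable (iter k G S R) u
  stable-iter k R u st v t =
    iter-inflationary k R u (st v (step-mono (iter k G S R) R u (iter-stable k R u st) v t))

  stable-or-grows : ∀ R u → Stable R u ⊎ # (T? ∘ R u) < # (T? ∘ step G S R u)
  stable-or-grows R u with Finₚ.any? (λ v → T? (step G S R u v) ×-dec ¬? (T? (R u v)))
  ... | yes (v , t , ¬Ruv) = inj₂ (#-strict (T? ∘ R u) (T? ∘ step G S R u) (λ _ → step-inflationary R u) t ¬Ruv)
  ... | no noGrowth        = inj₁ stable
    where
    stable : Stable R u
    stable v t with T? (R u v)
    ... | yes Ruv = Ruv
    ... | no ¬Ruv = contradiction (v , t , ¬Ruv) noGrowth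

  -- Row u has at most n elements and grows with each unstable step, so it cannot grow k more times
  -- once n ≤ (its size) + k.
  iter-stabilises : ∀ k R u → n ≤ # (T? ∘ R u) + k → Stable (iter k G S R) u
  iter-stabilises k R u bound with stable-or-grows R u
  ... | inj₁ stable = stable-iter k R u stable
  iter-stabilises zero    R u bound | inj₂ grows =
    contradiction (subst (n ≤_) (ℕₚ.+-identityʳ _) bound) (ℕₚ.<⇒≱ (ℕₚ.<-≤-trans grows (#≤n _)))
  iter-stabilises (suc k) R u bound | inj₂ grows =
    iter-stabilises k (step G S R) u (ℕₚ.≤-trans bound (ℕₚ.≤-trans (ℕₚ.≤-reflexive (ℕₚ.+-suc _ k))
                                                                   (ℕₚ.+-monoˡ-≤ k grows)))

  reach-complete : ∀ {u v} → Conn G S u v → T (reach G S u v)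
  reach-complete {u} = stable-closed (reach G S) u (iter-stabilises n _==_ u (ℕₚ.m≤n+m n _))
                                                   (iter-inflationary n _==_ u (==-refl u))

  Conn? : ∀ u → Decidable (Conn G S u)
  Conn? u v = Dec.map′ reach-sound reach-complete (T? (reach G S u v))

IsRoot : Graph n m → EdgeState m → Fin n → Set
IsRoot G S r = ∀ u → Conn G S r u → r ≤ᶠ u

isRoot? : (G : Graph n m) (S : EdgeState m) → Decidable (IsRoot G S)
isRoot? G S r = Finₚ.all? λ u → Conn? r u →-dec r Finₚ.≤? u

components≡#roots : (G : Graph n m) (S : EdgeState m) → components G S ≡ # isRoot? G S
components≡#roots {n} G S = trans (count-tabulate (T? ∘ isLeast) id) (#-cong (T? ∘ isLeast) (isRoot? G S) λ r → mk⇔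
    (λ t u r~u → toWitness (to (T-implies _ _) (to (allV-tabulate _ id) t u) (reach-complete r~u)))
    (λ ρ → from (allV-tabulate _ id) λ u → from (T-implies _ _) λ r~u → fromWitness (ρ u (reach-sound r~u))))
  where
  isLeast : Fin n → Bool
  isLeast r = allV (λ u → not (reach G S r u) ∨ ⌊ r Finₚ.≤? u ⌋) (allFin n)

module _ {G : Graph n m} {S : EdgeState m} where

  root-minimal : ∀ {r w} → IsRoot G S r → Conn G S r w → ¬ w <ᶠ r
  root-minimal ρ r~w = ℕₚ.≤⇒≯ (ρ _ r~w)

  roots-connected : ∀ {r₁ r₂} → IsRoot G S r₁ → IsRoot G S r₂ → Conn G S r₁ r₂ → r₁ ≡ r₂
  roots-connected ρ₁ ρ₂ r₁~r₂ = Finₚ.≤-antisym (ρ₁ _ r₁~r₂) (ρ₂ _ (Conn-sym r₁~r₂))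

  roots-uncrossed : ∀ {r₁ r₂ w₁ w₂} → IsRoot G S r₁ → IsRoot G S r₂ →
                    Conn G S r₁ w₂ → w₂ <ᶠ r₂ → Conn G S r₂ w₁ → w₁ <ᶠ r₁ → ⊥
  roots-uncrossed ρ₁ ρ₂ r₁~w₂ w₂<r₂ r₂~w₁ w₁<r₁ =
    ℕₚ.<-asym (ℕₚ.≤-<-trans (ρ₁ _ r₁~w₂) w₂<r₂) (ℕₚ.≤-<-trans (ρ₂ _ r₂~w₁) w₁<r₁)

  ¬root⇒below : ∀ {r} → ¬ IsRoot G S r → ∃ λ w → Conn G S r w × w <ᶠ r
  ¬root⇒below {r} ¬ρ with Finₚ.¬∀⟶∃¬ n _ (λ u → Conn? r u →-dec r Finₚ.≤? u) ¬ρ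
  ... | w , ¬[r~w⇒r≤w] with Conn? r w
  ...   | yes r~w = w , r~w , ℕₚ.≰⇒> λ r≤w → ¬[r~w⇒r≤w] λ _ → r≤w
  ...   | no ¬r~w = contradiction (λ r~w → contradiction r~w ¬r~w) ¬[r~w⇒r≤w]

-- An operational edge a — b only merges the components of a and b, so adding it destroys at most one root.
lost-root-unique : ∀ {G : Graph n m} {S a b r₁ r₂} →
                   IsRoot G S r₁ → ¬ IsRoot ((a , b) ∷ G) (true ∷ S) r₁ →
                   IsRoot G S r₂ → ¬ IsRoot ((a , b) ∷ G) (true ∷ S) r₂ → r₁ ≡ r₂
lost-root-unique ρ₁ ¬ρ₁′ ρ₂ ¬ρ₂′ with ¬root⇒below ¬ρ₁′ | ¬root⇒below ¬ρ₂′
... | w₁ , r₁~w₁ , w₁<r₁ | w₂ , r₂~w₂ , w₂<r₂ with Conn-∷-true⁻ r₁~w₁ | Conn-∷-true⁻ r₂~w₂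
... | inj₁ r₁~w₁′ | _ = contradiction w₁<r₁ (root-minimal ρ₁ r₁~w₁′)
... | inj₂ _ | inj₁ r₂~w₂′ = contradiction w₂<r₂ (root-minimal ρ₂ r₂~w₂′)
... | inj₂ (inj₁ (r₁~a , _)) | inj₂ (inj₁ (r₂~a , _)) = roots-connected ρ₁ ρ₂ (r₁~a ◅◅ Conn-sym r₂~a)
... | inj₂ (inj₂ (r₁~b , _)) | inj₂ (inj₂ (r₂~b , _)) = roots-connected ρ₁ ρ₂ (r₁~b ◅◅ Conn-sym r₂~b)
... | inj₂ (inj₁ (r₁~a , b~w₁)) | inj₂ (inj₂ (r₂~b , a~w₂)) =
  ⊥-elim (roots-uncrossed ρ₁ ρ₂ (r₁~a ◅◅ a~w₂) w₂<r₂ (r₂~b ◅◅ b~w₁) w₁<r₁)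
... | inj₂ (inj₂ (r₁~b , a~w₁)) | inj₂ (inj₁ (r₂~a , b~w₂)) =
  ⊥-elim (roots-uncrossed ρ₁ ρ₂ (r₁~b ◅◅ b~w₂) w₂<r₂ (r₂~a ◅◅ a~w₁) w₁<r₁)

components-lower-bound : (G : Graph n m) (S : EdgeState m) → n ≤ # isRoot? G S + count T? S
components-lower-bound {n} [] [] = ℕₚ.≤-trans (ℕₚ.≤-reflexive (sym all-roots)) (ℕₚ.m≤m+n _ 0)
  where
  all-roots : # isRoot? {n = n} [] [] ≡ n
  all-roots = #-all (isRoot? [] []) λ r u r~u → Finₚ.≤-reflexive (Conn-[] r~u)
components-lower-bound (e ∷ G) (false ∷ S) =
  subst (λ c → _ ≤ c + count T? S) roots-unchanged (components-lower-bound G S)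
  where
  roots-unchanged : # isRoot? G S ≡ # isRoot? (e ∷ G) (false ∷ S)
  roots-unchanged = #-cong (isRoot? G S) (isRoot? (e ∷ G) (false ∷ S)) λ r → mk⇔
    (λ ρ u r~u → ρ u (Conn-∷-false⁻ e r~u)) (λ ρ u r~u → ρ u (Conn-∷⁺ e false r~u))
components-lower-bound {n} ((a , b) ∷ G) (true ∷ S) = begin
  n                                                        ≤⟨ components-lower-bound G S ⟩
  # isRoot? G S + count T? S                               ≤⟨ ℕₚ.+-monoˡ-≤ _ at-most-one-lost ⟩
  suc (# isRoot? ((a , b) ∷ G) (true ∷ S)) + count T? S    ≡⟨ ℕₚ.+-suc _ _ ⟨
  # isRoot? ((a , b) ∷ G) (true ∷ S) + count T? (true ∷ S) ∎
  where
  open ℕₚ.≤-Reasoning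
  at-most-one-lost : # isRoot? G S ≤ suc (# isRoot? ((a , b) ∷ G) (true ∷ S))
  at-most-one-lost = #-≤-suc (isRoot? G S) (isRoot? _ _) lost-root-unique

splitEvent⇔ : ∀ {G : Graph n m} {s t S} → T (splitEvent G s t S) ⇔ (components G S ≡ 2 × ¬ Conn G S s t)
splitEvent⇔ = mk⇔
  (λ ev → let two , apart = to T-∧ ev in toWitness two , λ s~t → to (T-not _) apart (reach-complete s~t))
  (λ (two , apart) → from T-∧ (fromWitness two , from (T-not _) (apart ∘ reach-sound)))

count≡m⇒allOnes : (S : EdgeState m) → count T? S ≡ m → S ≡ allOnes m
count≡m⇒allOnes []          _  = refl
count≡m⇒allOnes (true ∷ S)  eq = cong (true ∷_) (count≡m⇒allOnes S (ℕₚ.suc-injective eq))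
count≡m⇒allOnes (false ∷ S) eq = contradiction eq (ℕₚ.<⇒≢ (s≤s (Vecₚ.count≤n T? S)))

suc-count≡m⇒one-false : (S : EdgeState m) → suc (count T? S) ≡ m → ∃ λ i → S ≡ allOnes m [ i ]≔ false
suc-count≡m⇒one-false (false ∷ S) eq = zero , cong (false ∷_) (count≡m⇒allOnes S (ℕₚ.suc-injective eq))
suc-count≡m⇒one-false (true ∷ S)  eq =
  let i , S≡ = suc-count≡m⇒one-false S (ℕₚ.suc-injective eq) in suc i , cong (true ∷_) S≡

split⇒one-failure : ∀ {H : Graph (suc m) m} {s t S} → Connected H → components H S ≡ 2 → ¬ Conn H S s t →
                    suc (count T? S) ≡ m
split⇒one-failure {m} {H} {s} {t} {S} H-conn two apart =
  ℕₚ.≤-antisym some-failure (ℕₚ.≤-pred at-most-one-failure)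
  where
  some-failure : count T? S < m
  some-failure = ℕₚ.≤∧≢⇒< (Vecₚ.count≤n T? S) λ all-on →
    apart (reach-sound (subst (λ S′ → T (reach H S′ s t)) (sym (count≡m⇒allOnes S all-on))
                              (from T-≡ (H-conn s t))))
  at-most-one-failure : suc m ≤ 2 + count T? S
  at-most-one-failure = subst (λ c → suc m ≤ c + count T? S) (trans (sym (components≡#roots H S)) two)
                              (components-lower-bound H S)

path : ∀ m → Graph (suc m) m
path m = tabulate λ i → inject₁ i , suc i

module _ {m} {S : EdgeState m} where

  path-adj : ∀ j → T (lookup S j) → Adj (path m) S (inject₁ j) (suc j)
  path-adj j on =
    adj j on (subst (λ e → Joins e (inject₁ j) (suc j)) (sym (Vecₚ.lookup∘tabulate _ j)) (inj₁ (refl , refl)))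

  path-adj⁻ : ∀ {x y} → Adj (path m) S x y → ∃ λ j → T (lookup S j) × Joins (inject₁ j , suc j) x y
  path-adj⁻ {x} {y} (adj j on joins) = j , on , subst (λ e → Joins e x y) (Vecₚ.lookup∘tabulate _ j) joins

path-connected : ∀ m → Connected (path m)
path-connected m u v = to T-≡ (reach-complete (Conn-sym (from-zero u) ◅◅ from-zero v))
  where
  from-zero : ∀ v → Conn (path m) (allOnes m) zero v
  from-zero = <-weakInduction _ ε λ j 0~j →
    0~j ◅◅ path-adj j (subst T (sym (Vecₚ.lookup-replicate j true)) _) ◅ ε

module _ {m} (i : Fin m) where

  private
    S = allOnes m [ i ]≔ false

  operational⇒≢ : ∀ {j} → T (lookup S j) → j ≢ i
  operational⇒≢ on refl = subst T (Vecₚ.lookup∘update i (allOnes m) false) on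

  ≢⇒operational : ∀ {j} → j ≢ i → T (lookup S j)
  ≢⇒operational {j} j≢i =
    subst T (sym (trans (Vecₚ.lookup∘update′ j≢i (allOnes m) false) (Vecₚ.lookup-replicate j true))) _

  Conn-stays-left : ∀ {u v} → Conn (path m) S u v → toℕ u ≤ toℕ i → toℕ v ≤ toℕ i
  Conn-stays-left ε u≤i = u≤i
  Conn-stays-left (u~w ◅ w~v) u≤i with path-adj⁻ u~w
  ... | j , on , inj₁ (refl , refl) =
    Conn-stays-left w~v (ℕₚ.≤∧≢⇒< (subst (_≤ toℕ i) (Finₚ.toℕ-inject₁ j) u≤i)
                                  (operational⇒≢ on ∘ Finₚ.toℕ-injective))
  ... | j , _  , inj₂ (refl , refl) =
    Conn-stays-left w~v (subst (_≤ toℕ i) (sym (Finₚ.toℕ-inject₁ j)) (ℕₚ.<⇒≤ u≤i))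

  ends-apart : ¬ Conn (path m) S zero (fromℕ m)
  ends-apart 0~m = ℕₚ.<⇒≱ (Finₚ.toℕ<n i) (subst (_≤ toℕ i) (Finₚ.toℕ-fromℕ m) (Conn-stays-left 0~m z≤n))

  nonzero-root≡suc : ∀ {r} → IsRoot (path m) S r → r ≢ zero → r ≡ suc i
  nonzero-root≡suc {zero}  ρ r≢0 = contradiction refl r≢0
  nonzero-root≡suc {suc j} ρ r≢0 with j Finₚ.≟ i
  ... | yes refl = refl
  ... | no j≢i   = contradiction (ρ _ (Adj-sym (path-adj j (≢⇒operational j≢i)) ◅ ε))
                                 (ℕₚ.<⇒≱ (s≤s (ℕₚ.≤-reflexive (Finₚ.toℕ-inject₁ j))))

one-failure⇒path-split : ∀ {m S} → suc (count T? S) ≡ m → T (splitEvent (path m) zero (fromℕ m) S)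
one-failure⇒path-split {m} {S} one-failure with suc-count≡m⇒one-false S one-failure
... | i , refl =
  from splitEvent⇔ (trans (components≡#roots (path m) S) (ℕₚ.≤-antisym at-most-two at-least-two) , ends-apart i)
  where
  single-zero : # (λ (v : Fin (suc m)) → v Finₚ.≟ zero) ≡ 1
  single-zero = cong suc (#-none {n = m} (λ j → suc j Finₚ.≟ zero) λ _ ())
  at-most-two : # isRoot? (path m) S ≤ 2
  at-most-two = ℕₚ.≤-trans
    (#-≤-suc (isRoot? (path m) S) (Finₚ._≟ zero) λ ρ₁ r₁≢0 ρ₂ r₂≢0 →
      trans (nonzero-root≡suc i ρ₁ r₁≢0) (sym (nonzero-root≡suc i ρ₂ r₂≢0)))
    (s≤s (ℕₚ.≤-reflexive single-zero))
  at-least-two : 2 ≤ # isRoot? (path m) S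
  at-least-two = ℕₚ.+-cancelʳ-≤ (count T? S) 2 _
    (subst (λ k → suc k ≤ # isRoot? (path m) S + count T? S) (sym one-failure) (components-lower-bound (path m) S))

-- `Sp G s t p` unfolds to `Pr p (splitEvent G s t) (allStates m)`.
Pr : ℚ → (EdgeState m → Bool) → List (EdgeState m) → ℚ
Pr p E = foldr (λ S acc → (if E S then prob p S else 0ℚ) ℚ.+ acc) 0ℚ

module _ {p : ℚ} (0≤p : 0ℚ ℚ.≤ p) (p≤1 : p ℚ.≤ 1ℚ) where

  private
    *-nonNeg : ∀ {a b} → 0ℚ ℚ.≤ a → 0ℚ ℚ.≤ b → 0ℚ ℚ.≤ a ℚ.* b
    *-nonNeg {a} {b} 0≤a 0≤b =
      ℚₚ.nonNegative⁻¹ _ {{ℚₚ.nonNeg*nonNeg⇒nonNeg a {{ℚ.nonNegative 0≤a}} b {{ℚ.nonNegative 0≤b}}}}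

    0≤1-p : 0ℚ ℚ.≤ 1ℚ ℚ.- p
    0≤1-p = subst (ℚ._≤ 1ℚ ℚ.- p) (ℚₚ.+-inverseʳ p) (ℚₚ.+-monoˡ-≤ (ℚ.- p) p≤1)

  prob-nonNeg : (S : EdgeState m) → 0ℚ ℚ.≤ prob p S
  prob-nonNeg []          = ℚₚ.nonNegative⁻¹ 1ℚ
  prob-nonNeg (true ∷ S)  = *-nonNeg 0≤p (prob-nonNeg S)
  prob-nonNeg (false ∷ S) = *-nonNeg 0≤1-p (prob-nonNeg S)

  Pr-mono : ∀ {E F : EdgeState m → Bool} → (∀ S → T (E S) → T (F S)) → ∀ Ss → Pr p E Ss ℚ.≤ Pr p F Ss
  Pr-mono E⇒F List.[] = ℚₚ.≤-refl
  Pr-mono {E = E} {F} E⇒F (S List.∷ Ss) = ℚₚ.+-mono-≤ term (Pr-mono E⇒F Ss)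
    where
    term : (if E S then prob p S else 0ℚ) ℚ.≤ (if F S then prob p S else 0ℚ)
    term with E S | F S | E⇒F S
    ... | true  | true  | _   = ℚₚ.≤-refl
    ... | true  | false | E⇒F = contradiction (E⇒F _) λ ()
    ... | false | true  | _   = prob-nonNeg S
    ... | false | false | _   = ℚₚ.≤-refl

path-optimal : ∀ m → Optimal (path (suc m)) zero (fromℕ (suc m))
path-optimal m = path-connected (suc m) , (λ ()) , λ H s t H-conn _ p 0<p p<1 →
  Pr-mono (ℚₚ.<⇒≤ 0<p) (ℚₚ.<⇒≤ p<1) (λ S split →
    let two , apart = to splitEvent⇔ split in one-failure⇒path-split (split⇒one-failure H-conn two apart))
    (allStates (suc m))

proposition2p1 : ∀ (n : ℕ) → 3 ≤ n →
    ∃ λ (G : Graph n (n ∸ 1)) → ∃ λ (s : Fin n) → ∃ λ (t : Fin n) → Optimal G s t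
proposition2p1 (suc (suc (suc k))) _ = path (suc (suc k)) , zero , fromℕ (suc (suc k)) , path-optimal (suc k)
proposition2p1 (suc (suc zero))    (s≤s (s≤s ()))
proposition2p1 (suc zero)          (s≤s ())
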